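{- Let $(X,H)$ be a hypergraph with at most continuum many connected components, each of which is countable. Then the poset $P(X,H)$ is $\sigma$-centred, i.e. $P(X,H)$ is a union of countably many centred subsets.
   Context: A hypergraph is a pair $(X,H)$ where $X$ is a set and $H$ (the set of edges) is a collection of finite subsets of $X$ of size at least $2$. Its connected components are the classes of the equivalence relation on $X$ generated by declaring $x\sim y$ whenever $x,y$ lie in a common edge. A subset $A\subseteq X$ is an anti-clique if no subset of $A$ belongs to $H$. $P(X,H)$ denotes the poset of all finite anti-cliques of $(X,H)$ ordered by reverse inclusion ($p\le q$ iff $p\supseteq q$). A subset $A$ of a poset is centred if every finite subset of $A$ has a common lower bound in the poset. -}

module Defs where

open import Level using (0ℓ)
open import Data.Nat using (ℕ)
open import Data.Bool using (Bool)
open import Data.List using (List)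
open import Data.List.Membership.Propositional using (_∈_)
open import Data.Product using (Σ; ∃; _×_; _,_; proj₁)
open import Data.Empty using (⊥)
open import Relation.Nullary using (¬_)
open import Relation.Binary.PropositionalEquality using (_≡_; _≢_)
open import Relation.Binary.Construct.Closure.Equivalence using (EqClosure)
open import Axiom.ExcludedMiddle using (ExcludedMiddle)

-- A hypergraph on X: an index set of edges E, each edge given by a finite
-- list of vertices (the edge is the set of list members), of size ≥ 2.
record Hypergraph (X : Set) : Set₁ where
  field
    E     : Set
    edge  : E → List X
    edge≥2 : ∀ e → ∃ λ x → ∃ λ y → x ∈ edge e × y ∈ edge e × x ≢ y
open Hypergraph public

module _ {X : Set} (G : Hypergraph X) where

  Adj : X → X → Set
  Adj x y = ∃ λ e → x ∈ edge G e × y ∈ edge G e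

  SameComp : X → X → Set
  SameComp = EqClosure Adj

  AntiClique : (X → Set) → Set
  AntiClique A = ¬ (∃ λ e → ∀ {x} → x ∈ edge G e → A x)

  -- P(X,H): finite anti-cliques (finite sets given by lists)
  PElem : Set
  PElem = Σ (List X) (λ p → AntiClique (λ x → x ∈ p))

  _≤P_ : PElem → PElem → Set
  p ≤P q = ∀ {x} → x ∈ proj₁ q → x ∈ proj₁ p

  Centred : (PElem → Set) → Set
  Centred C = ∀ (F : List PElem) → (∀ {q} → q ∈ F → C q) →
              ∃ λ r → ∀ {q} → q ∈ F → r ≤P q

  SigmaCentred : Set₁
  SigmaCentred = ∃ λ (C : ℕ → PElem → Set) →
                   (∀ p → ∃ λ n → C n p) × (∀ n → Centred (C n))

  -- at most continuum many components: an injection of the set of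
  -- components into 2^ℕ, i.e. a map X → (ℕ → Bool) constant on components
  -- and separating distinct components (equality of sequences pointwise)
  AtMostContinuumComps : Set
  AtMostContinuumComps = ∃ λ (g : X → (ℕ → Bool)) →
    (∀ x y → SameComp x y → ∀ n → g x n ≡ g y n) ×
    (∀ x y → (∀ n → g x n ≡ g y n) → SameComp x y)

  -- every component is countable: a map X → ℕ injective on each component
  CompsCountable : Set
  CompsCountable = ∃ λ (f : X → ℕ) →
    ∀ x y → SameComp x y → f x ≡ f y → x ≡ y

{-# OPTIONS --safe #-}
module Submission where

-- Label every vertex x by its value f x under a map injective on components,
-- and by a finite prefix of the sequence g x coding its component.  For a
-- finite anti-clique p, excluded middle yields a prefix length N so long
-- that vertices of p with equal N-prefixes lie in the same component.  The
-- list of labels, together with N, is a finite object, so there are only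
-- countably many such codes; the anti-cliques sharing a code form a centred
-- class.  Indeed, if q and q' share a code and y ∈ q lies in a component that
-- q' meets, then q' has a vertex z with the label of y; z lies in that
-- component because N separates the components met by q', and f is injective
-- there, so z = y.  Hence an edge inside the union of such anti-cliques,
-- which lies in a single component, lies inside one of them.

open import Defs
open import Level using (0ℓ)
open import Axiom.ExcludedMiddle using (ExcludedMiddle)
open import Function using (_∘_)
open import Data.Bool using (Bool; true; false) renaming (_≟_ to _≟ᵇ_)
open import Data.Nat using (ℕ; zero; suc; _≤_; _<_; _⊔_)
open import Data.Nat.Properties using (≤-refl; ≤-trans; ≤-pred; ≤∧≢⇒<; m≤m⊔n; m≤n⊔m)
  renaming (_≟_ to _≟ℕ_)
open import Data.Nat.Binary using (ℕᵇ; 2[1+_]; 1+[2_]; toℕ) renaming (zero to zeroᵇ)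
open import Data.Nat.Binary.Properties using (2[1+_]-injective; 1+[2_]-injective; toℕ-injective)
open import Data.List using (List; []; _∷_; [_]; _++_; map; concat)
open import Data.List.Properties using (∷-injective; ++-assoc; ++-identityʳ)
open import Data.List.Membership.Propositional using (_∈_; find)
open import Data.List.Membership.Propositional.Properties
  using (∈-map⁺; ∈-map⁻; ∈-concat⁺′; ∈-concat⁻)
open import Data.List.Relation.Unary.Any using (here; there)
open import Data.List.Relation.Unary.Any.Properties using (map⁻)
open import Data.Product using (∃; _×_; _,_; proj₁; proj₂)
open import Data.Product.Properties using (,-injectiveˡ; ,-injectiveʳ)
open import Relation.Nullary using (yes; no; contradiction)
open import Relation.Nullary.Negation using (¬∃⟶∀¬)
open import Relation.Nullary.Decidable using (decidable-stable)
open import Relation.Binary.Definitions using (DecidableEquality)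
open import Relation.Binary.PropositionalEquality using (_≡_; _≢_; refl; sym; trans; cong; subst)
open import Relation.Binary.Construct.Closure.Equivalence using (return; symmetric; transitive)

module _ {A : Set} where

  Agree : ℕ → (ℕ → A) → (ℕ → A) → Set
  Agree N h h′ = ∀ {n} → n < N → h n ≡ h′ n

  Agree-antimono : ∀ {M N h h′} → M ≤ N → Agree N h h′ → Agree M h h′
  Agree-antimono M≤N agree n<M = agree (≤-trans n<M M≤N)

  prefix : ℕ → (ℕ → A) → List A
  prefix zero    h = []
  prefix (suc N) h = h N ∷ prefix N h

  prefix-injective : ∀ {N h h′} → prefix N h ≡ prefix N h′ → Agree N h h′
  prefix-injective {suc N} eq {n} n<1+N with ∷-injective eq | n ≟ℕ N
  ... | head≡ , _     | yes refl = head≡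
  ... | _     , tail≡ | no n≢N   = prefix-injective tail≡ (≤∧≢⇒< (≤-pred n<1+N) n≢N)

  agreement-horizon : ExcludedMiddle 0ℓ → DecidableEquality A → (h h′ : ℕ → A) →
                      ∃ λ N → Agree N h h′ → ∀ n → h n ≡ h′ n
  agreement-horizon em _≟_ h h′ with em {∃ λ n → h n ≢ h′ n}
  ... | yes (n , hn≢h′n) = suc n , λ agree → contradiction (agree ≤-refl) hn≢h′n
  ... | no  ∄disagreement =
    0 , λ _ n → decidable-stable (h n ≟ h′ n) (¬∃⟶∀¬ ∄disagreement n)

uniform-bound : {A : Set} (P : A → ℕ → Set) → (∀ {a m n} → m ≤ n → P a m → P a n) →
                (∀ a → ∃ (P a)) → (xs : List A) → ∃ λ N → ∀ {a} → a ∈ xs → P a N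
uniform-bound P P-mono bound [] = 0 , λ ()
uniform-bound P P-mono bound (a ∷ xs) with bound a | uniform-bound P P-mono bound xs
... | n , Pan | m , Pxsm = n ⊔ m , λ where
  (here refl) → P-mono (m≤m⊔n n m) Pan
  (there a∈)  → P-mono (m≤n⊔m n m) (Pxsm a∈)

record PrefixCode (A : Set) : Set where
  field
    encode       : A → List Bool
    parse-unique : ∀ {a b} r s → encode a ++ r ≡ encode b ++ s → a ≡ b × r ≡ s

  encode-injective : ∀ {a b} → encode a ≡ encode b → a ≡ b
  encode-injective {a} {b} eq = proj₁ (parse-unique [] [] (padded))
    where
      padded : encode a ++ [] ≡ encode b ++ []
      padded = trans (++-identityʳ (encode a)) (trans eq (sym (++-identityʳ (encode b))))

open PrefixCode

Bool-code : PrefixCode Bool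
Bool-code = record { encode = [_] ; parse-unique = λ _ _ → ∷-injective }

unary : ℕ → List Bool
unary zero    = [ false ]
unary (suc n) = true ∷ unary n

unary-parse-unique : ∀ {m n} r s → unary m ++ r ≡ unary n ++ s → m ≡ n × r ≡ s
unary-parse-unique {zero}  {zero}  r s eq = refl , proj₂ (∷-injective eq)
unary-parse-unique {suc m} {suc n} r s eq with unary-parse-unique r s (proj₂ (∷-injective eq))
... | refl , r≡s = refl , r≡s

ℕ-code : PrefixCode ℕ
ℕ-code = record { encode = unary ; parse-unique = unary-parse-unique }

×-code : {A B : Set} → PrefixCode A → PrefixCode B → PrefixCode (A × B)
×-code {A} {B} cA cB = record { encode = encode-pair ; parse-unique = parse }
  where
    encode-pair : A × B → List Bool
    encode-pair (a , b) = encode cA a ++ encode cB b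

    parse : ∀ {p q} r s → encode-pair p ++ r ≡ encode-pair q ++ s → p ≡ q × r ≡ s
    parse {a , b} {a′ , b′} r s eq
      rewrite ++-assoc (encode cA a) (encode cB b) r | ++-assoc (encode cA a′) (encode cB b′) s
      with parse-unique cA _ _ eq
    ... | refl , rest with parse-unique cB r s rest
    ... | refl , r≡s = refl , r≡s

module _ {A : Set} (cA : PrefixCode A) where

  encode-list : List A → List Bool
  encode-list []       = [ false ]
  encode-list (a ∷ as) = true ∷ encode cA a ++ encode-list as

  encode-list-parse-unique : ∀ {as bs} r s → encode-list as ++ r ≡ encode-list bs ++ s →
                             as ≡ bs × r ≡ s
  encode-list-parse-unique {[]}     {[]}     r s eq = refl , proj₂ (∷-injective eq)
  encode-list-parse-unique {a ∷ as} {b ∷ bs} r s eq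
    rewrite ++-assoc (encode cA a) (encode-list as) r | ++-assoc (encode cA b) (encode-list bs) s
    with parse-unique cA _ _ (proj₂ (∷-injective eq))
  ... | refl , rest with encode-list-parse-unique r s rest
  ... | refl , r≡s = refl , r≡s

  List-code : PrefixCode (List A)
  List-code = record { encode = encode-list ; parse-unique = encode-list-parse-unique }

-- Bijective base-2 numeration.
fromBits : List Bool → ℕᵇ
fromBits []           = zeroᵇ
fromBits (false ∷ bs) = 2[1+ fromBits bs ]
fromBits (true ∷ bs)  = 1+[2 fromBits bs ]

fromBits-injective : ∀ {bs cs} → fromBits bs ≡ fromBits cs → bs ≡ cs
fromBits-injective {[]}         {[]}         _  = refl
fromBits-injective {false ∷ bs} {false ∷ cs} eq = cong (false ∷_) (fromBits-injective (2[1+_]-injective eq))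
fromBits-injective {true ∷ bs}  {true ∷ cs}  eq = cong (true ∷_) (fromBits-injective (1+[2_]-injective eq))
fromBits-injective {[]}         {false ∷ _}  ()
fromBits-injective {[]}         {true ∷ _}   ()
fromBits-injective {false ∷ _}  {[]}         ()
fromBits-injective {false ∷ _}  {true ∷ _}   ()
fromBits-injective {true ∷ _}   {[]}         ()
fromBits-injective {true ∷ _}   {false ∷ _}  ()

module _ {A : Set} (cA : PrefixCode A) where

  encodeℕ : A → ℕ
  encodeℕ = toℕ ∘ fromBits ∘ encode cA

  encodeℕ-injective : ∀ {a b} → encodeℕ a ≡ encodeℕ b → a ≡ b
  encodeℕ-injective = encode-injective cA ∘ fromBits-injective ∘ toℕ-injective

module _ {X : Set} (G : Hypergraph X) where

  Absorbs : List X → List X → Set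
  Absorbs q p = ∀ {x y} → x ∈ q → y ∈ p → SameComp G y x → y ∈ q

  ⋃ : List (PElem G) → List X
  ⋃ F = concat (map proj₁ F)

  ∈-⋃⁻ : ∀ F {x} → x ∈ ⋃ F → ∃ λ q → q ∈ F × x ∈ proj₁ q
  ∈-⋃⁻ F x∈ = find (map⁻ (∈-concat⁻ (map proj₁ F) x∈))

  ⋃-antiClique : ∀ F → (∀ {q q′} → q ∈ F → q′ ∈ F → Absorbs (proj₁ q′) (proj₁ q)) →
                 AntiClique G (_∈ ⋃ F)
  ⋃-antiClique F absorbs (e , e⊆⋃) with edge≥2 G e
  ... | x , _ , x∈e , _ with ∈-⋃⁻ F (e⊆⋃ x∈e)
  ... | q′ , q′∈F , x∈q′ = proj₂ q′ (e , e⊆q′)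
    where
      e⊆q′ : ∀ {y} → y ∈ edge G e → y ∈ proj₁ q′
      e⊆q′ y∈e with ∈-⋃⁻ F (e⊆⋃ y∈e)
      ... | q , q∈F , y∈q = absorbs q∈F q′∈F x∈q′ y∈q (return (e , y∈e , x∈e))

  pairwise-absorbing⇒centred : (C : PElem G → Set) →
                               (∀ q q′ → C q → C q′ → Absorbs (proj₁ q′) (proj₁ q)) →
                               Centred G C
  pairwise-absorbing⇒centred C absorbs F F⊆C =
    (⋃ F , ⋃-antiClique F (λ q∈F q′∈F → absorbs _ _ (F⊆C q∈F) (F⊆C q′∈F))) ,
    λ q∈F x∈q → ∈-concat⁺′ x∈q (∈-map⁺ proj₁ q∈F)

module Coding (em : ExcludedMiddle 0ℓ) {X : Set} (G : Hypergraph X)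
  (g : X → ℕ → Bool) (g-const : ∀ x y → SameComp G x y → ∀ n → g x n ≡ g y n)
  (g-sep : ∀ x y → (∀ n → g x n ≡ g y n) → SameComp G x y)
  (f : X → ℕ) (f-inj : ∀ x y → SameComp G x y → f x ≡ f y → x ≡ y) where

  SeparatedBy : ℕ → X → X → Set
  SeparatedBy N x y = Agree N (g x) (g y) → SameComp G x y

  SeparatedBy-mono : ∀ {M N x y} → M ≤ N → SeparatedBy M x y → SeparatedBy N x y
  SeparatedBy-mono M≤N sep = sep ∘ Agree-antimono M≤N

  separating-length-pair : ∀ x y → ∃ λ N → SeparatedBy N x y
  separating-length-pair x y = let N , agree⇒equal = agreement-horizon em _≟ᵇ_ (g x) (g y)
                               in N , g-sep x y ∘ agree⇒equal

  Separates : ℕ → List X → Set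
  Separates N p = ∀ {x y} → x ∈ p → y ∈ p → SeparatedBy N x y

  separating-length : ∀ p → ∃ λ N → Separates N p
  separating-length p =
    let N , sep = uniform-bound (λ x N → ∀ {y} → y ∈ p → SeparatedBy N x y)
                                (λ M≤N sep y∈p → SeparatedBy-mono M≤N (sep y∈p))
                                (λ x → uniform-bound (λ y N → SeparatedBy N x y) SeparatedBy-mono
                                                     (separating-length-pair x) p)
                                p
    in N , λ x∈p → sep x∈p

  label : ℕ → X → List Bool × ℕ
  label N x = prefix N (g x) , f x

  Code : Set
  Code = ℕ × List (List Bool × ℕ)

  code : ℕ → List X → Code
  code N p = N , map (label N) p

  Code-prefixCode : PrefixCode Code
  Code-prefixCode = ×-code ℕ-code (List-code (×-code (List-code Bool-code) ℕ-code))

  same-labels⇒absorbs : ∀ {N q q′} → Separates N q′ → map (label N) q ≡ map (label N) q′ →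
                        Absorbs G q′ q
  same-labels⇒absorbs {N} {q} {q′} sep′ labels≡ {x} {y} x∈q′ y∈q y~x
    with ∈-map⁻ (label N) (subst (label N y ∈_) labels≡ (∈-map⁺ (label N) y∈q))
  ... | z , z∈q′ , label-y≡label-z = subst (_∈ q′) z≡y z∈q′
    where
      z~x : SameComp G z x
      z~x = sep′ z∈q′ x∈q′ λ {n} n<N →
        trans (sym (prefix-injective (,-injectiveˡ label-y≡label-z) n<N)) (g-const y x y~x n)

      z≡y : z ≡ y
      z≡y = f-inj z y (transitive (Adj G) z~x (symmetric (Adj G) y~x))
                      (sym (,-injectiveʳ label-y≡label-z))

  Class : ℕ → PElem G → Set
  Class k q = ∃ λ N → Separates N (proj₁ q) × encodeℕ Code-prefixCode (code N (proj₁ q)) ≡ k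

  Class-covers : ∀ q → ∃ λ k → Class k q
  Class-covers q = let N , sep = separating-length (proj₁ q)
                   in encodeℕ Code-prefixCode (code N (proj₁ q)) , N , sep , refl

  Class-centred : ∀ k → Centred G (Class k)
  Class-centred k = pairwise-absorbing⇒centred G (Class k) absorbs
    where
      absorbs : ∀ q q′ → Class k q → Class k q′ → Absorbs G (proj₁ q′) (proj₁ q)
      absorbs q q′ (N , _ , refl) (N′ , sep′ , codes≡)
        with encodeℕ-injective Code-prefixCode {code N (proj₁ q)} {code N′ (proj₁ q′)} (sym codes≡)
      ... | codes≡′ with ,-injectiveˡ codes≡′
      ... | refl = same-labels⇒absorbs sep′ (,-injectiveʳ codes≡′)

theorem4 : ExcludedMiddle 0ℓ → (X : Set) → (G : Hypergraph X) →
    AtMostContinuumComps G → CompsCountable G → SigmaCentred G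
theorem4 em X G (g , g-const , g-sep) (f , f-inj) = Class , Class-covers , Class-centred
  where open Coding em G g g-const g-sep f f-inj
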